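{- The linear map $\mathsf{QSym}\to\mathsf{QSym}$ with $L_\beta\mapsto L_{\beta^{\mathtt r}}$ for all compositions $\beta$ sends $K_\alpha\mapsto K_{\alpha^\flat}$ for each peak composition $\alpha$.
   Context: For a composition $\alpha=(\alpha_1,\dots,\alpha_r)\vDash N$, $I(\alpha)=\{\alpha_1,\alpha_1+\alpha_2,\dots,\alpha_1+\cdots+\alpha_{r-1}\}$ and $\alpha^{\mathtt r}=(\alpha_r,\dots,\alpha_1)$. $M_\gamma=\sum_{i_1<\cdots<i_s}x_{i_1}^{\gamma_1}\cdots x_{i_s}^{\gamma_s}$ ($M_\emptyset=1$) and $L_\alpha=\sum_{\gamma\vDash N,\,I(\alpha)\subseteq I(\gamma)}M_\gamma$; $\mathsf{QSym}$ is the span of all $M_\gamma$ over a field $\mathbb{k}$. A peak composition is $\alpha=(\alpha_1,\dots,\alpha_r)$ with $\alpha_i\ge2$ for $1\le i<r$; for such $\alpha$, $\alpha^\flat=(\alpha_r+1,\alpha_{r-1},\dots,\alpha_2,\alpha_1-1)$ and $K_\alpha=\sum_{\gamma\vDash N,\ I(\alpha)\subseteq I(\gamma)\cup(I(\gamma)+1)}2^{\ell(\gamma)}M_\gamma$, with $\ell(\gamma)$ the number of parts of $\gamma$. -}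

module Defs where

open import Level using (Level; _⊔_) renaming (suc to lsuc)
open import Data.Nat using (ℕ; zero; suc; _+_; _∸_; _≤_; _≡ᵇ_)
open import Data.Bool using (Bool; true; false; if_then_else_; _∧_)
open import Data.Bool.ListAction using (and; or)
open import Data.List using (List; []; _∷_; [_]; _++_; map; reverse; length; concatMap)
open import Data.Nat.ListAction using (sum)
open import Data.List.Properties using (≡-dec)
open import Data.List.Relation.Unary.All using (All)
open import Data.Product using (∃; _×_; _,_)
open import Relation.Nullary using (¬_; does)
open import Algebra.Bundles using (CommutativeRing)
import Data.Nat as ℕ

record Field (c ℓ : Level) : Set (lsuc (c ⊔ ℓ)) where
  field
    commutativeRing : CommutativeRing c ℓ
  open CommutativeRing commutativeRing public
  field
    1≉0     : ¬ (1# ≈ 0#)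
    inverse : ∀ x → ¬ (x ≈ 0#) → ∃ λ y → x * y ≈ 1#

IsComposition : List ℕ → Set
IsComposition β = All (λ a → 1 ≤ a) β

-- All compositions of N, each exactly once.
-- compsSuc n lists the compositions of n+1: build from (1) by, at each
-- step, either prepending a new part 1 or incrementing the first part.
incHead : List ℕ → List ℕ
incHead []       = []
incHead (x ∷ xs) = suc x ∷ xs

decHead : List ℕ → List ℕ
decHead []       = []
decHead (x ∷ xs) = x ∸ 1 ∷ xs

compsSuc : ℕ → List (List ℕ)
compsSuc zero    = [ [ 1 ] ]
compsSuc (suc n) = concatMap (λ γ → (1 ∷ γ) ∷ incHead γ ∷ []) (compsSuc n)

compositions : ℕ → List (List ℕ)
compositions zero    = [ [] ]
compositions (suc n) = compsSuc n

I : List ℕ → List ℕ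
I []           = []
I (a ∷ [])     = []
I (a ∷ b ∷ bs) = a ∷ map (a +_) (I (b ∷ bs))

_∈ᵇ_ : ℕ → List ℕ → Bool
n ∈ᵇ xs = or (map (n ≡ᵇ_) xs)

_⊆ᵇ_ : List ℕ → List ℕ → Bool
xs ⊆ᵇ ys = and (map (_∈ᵇ ys) xs)

data IsPeak : List ℕ → Set where
  single : ∀ {a} → 1 ≤ a → IsPeak [ a ]
  cons   : ∀ {a b bs} → 2 ≤ a → IsPeak (b ∷ bs) → IsPeak (a ∷ b ∷ bs)

-- α♭ = (α_r + 1, α_{r-1}, …, α₂, α₁ - 1)
decLast : List ℕ → List ℕ
decLast l = reverse (decHead (reverse l))

flat : List ℕ → List ℕ
flat α = decLast (incHead (reverse α))

-- QSym over a field F, modelled in its monomial basis: an element is a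
-- finite formal sum Σ c · M_γ, given as a list of (coefficient, γ) pairs;
-- two such sums are equal when every M_γ has the same total coefficient.

module QSymOver {c ℓ} (F : Field c ℓ) where
  open Field F renaming (_+_ to _+ᶠ_; _*_ to _*ᶠ_)

  QSym : Set c
  QSym = List (Carrier × List ℕ)

  coeff : QSym → List ℕ → Carrier
  coeff []             γ = 0#
  coeff ((a , δ) ∷ f) γ = (if does (≡-dec ℕ._≟_ δ γ) then a else 0#) +ᶠ coeff f γ

  infix 4 _≋_
  _≋_ : QSym → QSym → Set ℓ
  f ≋ g = ∀ γ → coeff f γ ≈ coeff g γ

  _⊕_ : QSym → QSym → QSym
  f ⊕ g = f ++ g

  _·_ : Carrier → QSym → QSym
  a · f = map (λ { (b , γ) → (a *ᶠ b , γ) }) f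

  record IsLinear (φ : QSym → QSym) : Set (c ⊔ ℓ) where
    field
      cong-≋ : ∀ f g → f ≋ g → φ f ≋ φ g
      additive : ∀ f g → φ (f ⊕ g) ≋ φ f ⊕ φ g
      homogeneous : ∀ a f → φ (a · f) ≋ a · φ f

  two^ : ℕ → Carrier
  two^ zero    = 1#
  two^ (suc n) = (1# +ᶠ 1#) *ᶠ two^ n

  M : List ℕ → QSym
  M γ = [ (1# , γ) ]

  L : List ℕ → QSym
  L α = concatMap (λ γ → if I α ⊆ᵇ I γ then [ (1# , γ) ] else [])
                  (compositions (sum α))

  K : List ℕ → QSym
  K α = concatMap (λ γ → if I α ⊆ᵇ (I γ ++ map suc (I γ))
                           then [ (two^ (length γ) , γ) ] else [])
                  (compositions (sum α))

-- Compositions of n + 1 correspond to boolean words of length n (the indicator of I(γ)), and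
-- refinement of compositions becomes the componentwise order of words. As L_β is M_β plus
-- monomials of strictly finer compositions, downward induction on refinement turns the
-- hypothesis on the L_β into φ(M_γ) = M_{γʳ} for every composition γ: φ is the reversal ρ of
-- monomial labels. With N = |α| one has I(γʳ) = N − I(γ) and I(α♭) = I(αʳ) + 1, so γ satisfies
-- the condition defining K_α exactly when γʳ satisfies the one defining K_{α♭}; as ℓ(γʳ) = ℓ(γ),
-- ρ(K_α) = K_{α♭}.

module Submission where

open import Defs
open import Data.Bool using (Bool; true; false; if_then_else_; not; _∧_; _∨_)
open import Data.Bool.Properties using (∨-comm; ∨-assoc; ∧-comm; ∧-assoc; ∨-isCommutativeMonoid; ∧-isCommutativeMonoid) renaming (_≟_ to _≟ᵇ_)
open import Data.Bool.ListAction using (and; or)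
open import Data.Empty using (⊥-elim)
open import Data.List using (List; []; _∷_; [_]; _++_; map; reverse; length; concatMap)
open import Data.List.Properties using (≡-dec; map-++; map-∘; map-cong; map-cong-local; ++-identityʳ; concatMap-cong; concatMap-map; map-concatMap; unfold-reverse; reverse-map; reverse-++; reverse-involutive; length-reverse)
open import Data.List.Relation.Binary.Permutation.Propositional using (_↭_; ↭⇒↭ₛ)
open import Data.List.Relation.Binary.Permutation.Propositional.Properties using (↭-reverse) renaming (map⁺ to ↭-map⁺)
open import Data.List.Relation.Binary.Permutation.Setoid.Properties using (foldr-commMonoid)
open import Data.List.Relation.Unary.All as All using (All; []; _∷_; universal)
open import Data.List.Relation.Unary.All.Properties using (concat⁺) renaming (map⁺ to All-map⁺)
open import Data.Nat using (ℕ; zero; suc; _+_; _∸_; _≤_; _<_; _≡ᵇ_; z≤n; s≤s)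
open import Data.Nat.ListAction using (sum)
import Data.Nat.Properties as ℕ
open import Data.Nat.ListAction.Properties using (sum-++; sum-↭)
open import Data.Nat.Properties using (_≟_; +-suc; ≤-refl; ≤-trans; m≤m+n; m≤n⇒m≤1+n; +-monoʳ-≤; <⇒≢; <⇒≤; m+n∸m≡n; [m+n]∸[m+o]≡n∸o; m∸[m∸n]≡n; +-∸-assoc)
open import Data.Product using (_,_; proj₂; map₂)
open import Data.Vec as Vec using (Vec; []; _∷_; _∷ʳ_)
import Data.Vec.Properties as Vec
open import Function using (_∘_; mk⇔)
open import Relation.Binary using (Setoid)
open import Relation.Binary.PropositionalEquality as ≡ using (_≡_; _≢_; refl; sym; trans; cong; cong₂; subst; module ≡-Reasoning)
open import Relation.Nullary using (Dec; does; yes; no)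
open import Relation.Nullary.Decidable using (dec-false; does-⇔)
import Relation.Binary.Reasoning.Setoid as SetoidReasoning
import Algebra.Properties.Ring as RingProperties
import Algebra.Properties.CommutativeSemigroup as CommutativeSemigroupProperties

private variable n : ℕ

or-↭ : ∀ {bs cs} → bs ↭ cs → or bs ≡ or cs
or-↭ p = foldr-commMonoid (≡.setoid Bool) ∨-isCommutativeMonoid (↭⇒↭ₛ p)

and-↭ : ∀ {bs cs} → bs ↭ cs → and bs ≡ and cs
and-↭ p = foldr-commMonoid (≡.setoid Bool) ∧-isCommutativeMonoid (↭⇒↭ₛ p)

∈ᵇ-reverse : ∀ x A → x ∈ᵇ reverse A ≡ x ∈ᵇ A
∈ᵇ-reverse x A = or-↭ (↭-map⁺ (x ≡ᵇ_) (↭-reverse A))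

⊆ᵇ-reverse : ∀ A B → reverse A ⊆ᵇ B ≡ A ⊆ᵇ B
⊆ᵇ-reverse A B = and-↭ (↭-map⁺ (_∈ᵇ B) (↭-reverse A))

∈ᵇ-++ : ∀ x A B → x ∈ᵇ (A ++ B) ≡ (x ∈ᵇ A) ∨ (x ∈ᵇ B)
∈ᵇ-++ x []      B = refl
∈ᵇ-++ x (a ∷ A) B = trans (cong ((x ≡ᵇ a) ∨_) (∈ᵇ-++ x A B)) (sym (∨-assoc (x ≡ᵇ a) _ _))

∉⇒∈ᵇ≡false : ∀ {x A} → All (x ≢_) A → x ∈ᵇ A ≡ false
∉⇒∈ᵇ≡false []                     = refl
∉⇒∈ᵇ≡false {x} {a ∷ _} (x≢a ∷ p) = cong₂ _∨_ (dec-false (x ≟ a) x≢a) (∉⇒∈ᵇ≡false p)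

suc-∈ᵇ-map-suc : ∀ x A → suc x ∈ᵇ map suc A ≡ x ∈ᵇ A
suc-∈ᵇ-map-suc x []      = refl
suc-∈ᵇ-map-suc x (a ∷ A) = cong ((x ≡ᵇ a) ∨_) (suc-∈ᵇ-map-suc x A)

0-∈ᵇ-map-suc : ∀ A → 0 ∈ᵇ map suc A ≡ false
0-∈ᵇ-map-suc []      = refl
0-∈ᵇ-map-suc (_ ∷ A) = 0-∈ᵇ-map-suc A

0-∉ᵇ-positive : ∀ {A} → All (1 ≤_) A → 0 ∈ᵇ A ≡ false
0-∉ᵇ-positive []              = refl
0-∉ᵇ-positive (s≤s _ ∷ 1≤A) = 0-∉ᵇ-positive 1≤A

map-suc-⊆ᵇ-map-suc : ∀ A B → map suc A ⊆ᵇ map suc B ≡ A ⊆ᵇ B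
map-suc-⊆ᵇ-map-suc []      B = refl
map-suc-⊆ᵇ-map-suc (a ∷ A) B = cong₂ _∧_ (suc-∈ᵇ-map-suc a B) (map-suc-⊆ᵇ-map-suc A B)

map-suc-⊆ᵇ-1∷map-suc : ∀ {A} B → All (1 ≤_) A → map suc A ⊆ᵇ (1 ∷ map suc B) ≡ A ⊆ᵇ B
map-suc-⊆ᵇ-1∷map-suc B []                      = refl
map-suc-⊆ᵇ-1∷map-suc {suc a ∷ _} B (_ ∷ 1≤A) =
  cong₂ _∧_ (suc-∈ᵇ-map-suc (suc a) B) (map-suc-⊆ᵇ-1∷map-suc B 1≤A)

∈ᵇ-map-∸ : ∀ {N x A} → x ≤ N → All (_≤ N) A → x ∈ᵇ map (N ∸_) A ≡ (N ∸ x) ∈ᵇ A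
∈ᵇ-map-∸ x≤N [] = refl
∈ᵇ-map-∸ {N} {x} {a ∷ _} x≤N (a≤N ∷ A≤N) =
  cong₂ _∨_ (does-⇔ (mk⇔ to from) (x ≟ N ∸ a) (N ∸ x ≟ a)) (∈ᵇ-map-∸ x≤N A≤N)
  where
  to : x ≡ N ∸ a → N ∸ x ≡ a
  to e = trans (cong (N ∸_) e) (m∸[m∸n]≡n a≤N)
  from : N ∸ x ≡ a → x ≡ N ∸ a
  from e = trans (sym (m∸[m∸n]≡n x≤N)) (cong (N ∸_) e)

I-incHead : ∀ γ → I (incHead γ) ≡ map suc (I γ)
I-incHead []           = refl
I-incHead (x ∷ [])     = refl
I-incHead (x ∷ y ∷ ys) = cong (suc x ∷_) (map-∘ (I (y ∷ ys)))

I-positive : ∀ {γ} → IsComposition γ → All (1 ≤_) (I γ)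
I-positive []                 = []
I-positive (_ ∷ [])           = []
I-positive {a ∷ b ∷ bs} (1≤a ∷ _) =
  1≤a ∷ All-map⁺ (universal (λ x → ≤-trans 1≤a (m≤m+n a x)) (I (b ∷ bs)))

I-≤-sum : ∀ γ → All (_≤ sum γ) (I γ)
I-≤-sum []           = []
I-≤-sum (x ∷ [])     = []
I-≤-sum (x ∷ y ∷ ys) = m≤m+n x _ ∷ All-map⁺ (All.map (+-monoʳ-≤ x) (I-≤-sum (y ∷ ys)))

I-∷ʳ : ∀ δ a → 0 < length δ → I (δ ++ [ a ]) ≡ I δ ++ [ sum δ ]
I-∷ʳ (x ∷ [])     a _ = cong [_] (sym (ℕ.+-identityʳ x))
I-∷ʳ (x ∷ y ∷ ys) a _ = cong (x ∷_) (begin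
  map (x +_) (I ((y ∷ ys) ++ [ a ]))           ≡⟨ cong (map (x +_)) (I-∷ʳ (y ∷ ys) a (s≤s z≤n)) ⟩
  map (x +_) (I (y ∷ ys) ++ [ sum (y ∷ ys) ])  ≡⟨ map-++ (x +_) (I (y ∷ ys)) _ ⟩
  map (x +_) (I (y ∷ ys)) ++ [ x + sum (y ∷ ys) ] ∎)
  where open ≡-Reasoning

sum-reverse : ∀ γ → sum (reverse γ) ≡ sum γ
sum-reverse γ = sum-↭ (↭-reverse γ)

I-reverse : ∀ γ → I (reverse γ) ≡ map (sum γ ∸_) (reverse (I γ))
I-reverse []           = refl
I-reverse (x ∷ [])     = refl
I-reverse (x ∷ xs@(_ ∷ _)) = begin
  I (reverse (x ∷ xs))                        ≡⟨ cong I (unfold-reverse x xs) ⟩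
  I (reverse xs ++ [ x ])                     ≡⟨ I-∷ʳ (reverse xs) x reverse-nonempty ⟩
  I (reverse xs) ++ [ sum (reverse xs) ]      ≡⟨ cong₂ _++_ (I-reverse xs) (cong [_] (sum-reverse xs)) ⟩
  map (S ∸_) (reverse (I xs)) ++ [ S ]        ≡⟨ cong₂ _++_ shift (cong [_] (sym (m+n∸m≡n x S))) ⟩
  map f (reverse (map (x +_) (I xs))) ++ [ f x ]  ≡⟨ map-++ f (reverse (map (x +_) (I xs))) [ x ] ⟨
  map f (reverse (map (x +_) (I xs)) ++ [ x ])    ≡⟨ cong (map f) (unfold-reverse x (map (x +_) (I xs))) ⟨
  map f (reverse (x ∷ map (x +_) (I xs)))     ∎
  where
  open ≡-Reasoning
  S  = sum xs
  f  = (x + S) ∸_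
  reverse-nonempty : 0 < length (reverse xs)
  reverse-nonempty = subst (0 <_) (sym (length-reverse xs)) (s≤s z≤n)
  shift : map (S ∸_) (reverse (I xs)) ≡ map f (reverse (map (x +_) (I xs)))
  shift = begin
    map (S ∸_) (reverse (I xs))           ≡⟨ map-cong (λ a → sym ([m+n]∸[m+o]≡n∸o x S a)) (reverse (I xs)) ⟩
    map (f ∘ (x +_)) (reverse (I xs))     ≡⟨ map-∘ (reverse (I xs)) ⟩
    map f (map (x +_) (reverse (I xs)))   ≡⟨ cong (map f) (reverse-map (x +_) (I xs)) ⟩
    map f (reverse (map (x +_) (I xs)))   ∎

∈ᵇ-I-reverse : ∀ γ {x} → x ≤ sum γ → x ∈ᵇ I (reverse γ) ≡ (sum γ ∸ x) ∈ᵇ I γ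
∈ᵇ-I-reverse γ {x} x≤N = begin
  x ∈ᵇ I (reverse γ)                      ≡⟨ cong (x ∈ᵇ_) (I-reverse γ) ⟩
  x ∈ᵇ map (sum γ ∸_) (reverse (I γ))     ≡⟨ cong (x ∈ᵇ_) (reverse-map (sum γ ∸_) (I γ)) ⟩
  x ∈ᵇ reverse (map (sum γ ∸_) (I γ))     ≡⟨ ∈ᵇ-reverse x (map (sum γ ∸_) (I γ)) ⟩
  x ∈ᵇ map (sum γ ∸_) (I γ)               ≡⟨ ∈ᵇ-map-∸ x≤N (I-≤-sum γ) ⟩
  (sum γ ∸ x) ∈ᵇ I γ                      ∎
  where open ≡-Reasoning

I⁺ : List ℕ → List ℕ
I⁺ γ = I γ ++ map suc (I γ)

∈ᵇ-I⁺-reverse : ∀ γ {x} → x ≤ sum γ → x ∈ᵇ I⁺ (reverse γ) ≡ suc (sum γ ∸ x) ∈ᵇ I⁺ γ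
∈ᵇ-I⁺-reverse γ {zero} _ = begin
  0 ∈ᵇ (A′ ++ map suc A′)              ≡⟨ ∈ᵇ-++ 0 A′ (map suc A′) ⟩
  (0 ∈ᵇ A′) ∨ (0 ∈ᵇ map suc A′)        ≡⟨ cong₂ _∨_ (∈ᵇ-I-reverse γ z≤n) (0-∈ᵇ-map-suc A′) ⟩
  (N ∈ᵇ A) ∨ false                     ≡⟨ ∨-comm (N ∈ᵇ A) false ⟩
  false ∨ (N ∈ᵇ A)                     ≡⟨ cong₂ _∨_ N+1∉A (suc-∈ᵇ-map-suc N A) ⟨
  (suc N ∈ᵇ A) ∨ (suc N ∈ᵇ map suc A)  ≡⟨ ∈ᵇ-++ (suc N) A (map suc A) ⟨
  suc N ∈ᵇ (A ++ map suc A)            ∎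
  where
  open ≡-Reasoning
  N  = sum γ
  A  = I γ
  A′ = I (reverse γ)
  N+1∉A : suc N ∈ᵇ A ≡ false
  N+1∉A = ∉⇒∈ᵇ≡false (All.map (λ x≤N e → <⇒≢ (s≤s x≤N) (sym e)) (I-≤-sum γ))
∈ᵇ-I⁺-reverse γ {suc b} b<N = begin
  suc b ∈ᵇ (A′ ++ map suc A′)            ≡⟨ ∈ᵇ-++ (suc b) A′ (map suc A′) ⟩
  (suc b ∈ᵇ A′) ∨ (suc b ∈ᵇ map suc A′)  ≡⟨ cong₂ _∨_ (∈ᵇ-I-reverse γ b<N) b+1∈A′+1 ⟩
  (m ∈ᵇ A) ∨ (suc m ∈ᵇ A)                ≡⟨ ∨-comm (m ∈ᵇ A) (suc m ∈ᵇ A) ⟩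
  (suc m ∈ᵇ A) ∨ (m ∈ᵇ A)                ≡⟨ cong ((suc m ∈ᵇ A) ∨_) (suc-∈ᵇ-map-suc m A) ⟨
  (suc m ∈ᵇ A) ∨ (suc m ∈ᵇ map suc A)    ≡⟨ ∈ᵇ-++ (suc m) A (map suc A) ⟨
  suc m ∈ᵇ (A ++ map suc A)              ∎
  where
  open ≡-Reasoning
  m  = sum γ ∸ suc b
  A  = I γ
  A′ = I (reverse γ)
  b+1∈A′+1 : suc b ∈ᵇ map suc A′ ≡ suc m ∈ᵇ A
  b+1∈A′+1 = begin
    suc b ∈ᵇ map suc A′   ≡⟨ suc-∈ᵇ-map-suc b A′ ⟩
    b ∈ᵇ A′               ≡⟨ ∈ᵇ-I-reverse γ (<⇒≤ b<N) ⟩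
    (sum γ ∸ b) ∈ᵇ A      ≡⟨ cong (_∈ᵇ A) (+-∸-assoc 1 b<N) ⟩
    suc m ∈ᵇ A            ∎

⊆ᵇ-I⁺-reverse : ∀ α γ → sum γ ≡ sum α →
                I α ⊆ᵇ I⁺ (reverse γ) ≡ map suc (I (reverse α)) ⊆ᵇ I⁺ γ
⊆ᵇ-I⁺-reverse α γ eq = begin
  and (map (_∈ᵇ I⁺ (reverse γ)) (I α))   ≡⟨ cong and (map-cong-local (All.map (∈ᵇ-I⁺-reverse γ) I-α≤N)) ⟩
  and (map ((_∈ᵇ I⁺ γ) ∘ g) (I α))       ≡⟨ cong and (map-∘ (I α)) ⟩
  map g (I α) ⊆ᵇ I⁺ γ                    ≡⟨ ⊆ᵇ-reverse (map g (I α)) (I⁺ γ) ⟨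
  reverse (map g (I α)) ⊆ᵇ I⁺ γ          ≡⟨ cong (_⊆ᵇ I⁺ γ) (reverse-map g (I α)) ⟨
  map g (reverse (I α)) ⊆ᵇ I⁺ γ          ≡⟨ cong (_⊆ᵇ I⁺ γ) (map-∘ (reverse (I α))) ⟩
  map suc (map (N ∸_) (reverse (I α))) ⊆ᵇ I⁺ γ  ≡⟨ cong (λ A → map suc A ⊆ᵇ I⁺ γ) I-reverse-α ⟨
  map suc (I (reverse α)) ⊆ᵇ I⁺ γ        ∎
  where
  open ≡-Reasoning
  N = sum γ
  g : ℕ → ℕ
  g x = suc (N ∸ x)
  I-α≤N : All (_≤ N) (I α)
  I-α≤N = subst (λ m → All (_≤ m) (I α)) (sym eq) (I-≤-sum α)
  I-reverse-α : I (reverse α) ≡ map (N ∸_) (reverse (I α))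
  I-reverse-α = trans (I-reverse α) (cong (λ m → map (m ∸_) (reverse (I α))) (sym eq))

-- The map α ↦ α♭

decLast-∷ʳ : ∀ δ a → decLast (δ ++ [ a ]) ≡ δ ++ [ a ∸ 1 ]
decLast-∷ʳ δ a = begin
  reverse (decHead (reverse (δ ++ [ a ])))  ≡⟨ cong (reverse ∘ decHead) (reverse-++ δ [ a ]) ⟩
  reverse ((a ∸ 1) ∷ reverse δ)             ≡⟨ unfold-reverse (a ∸ 1) (reverse δ) ⟩
  reverse (reverse δ) ++ [ a ∸ 1 ]          ≡⟨ cong (_++ [ a ∸ 1 ]) (reverse-involutive δ) ⟩
  δ ++ [ a ∸ 1 ]                            ∎
  where open ≡-Reasoning

I-decLast-incHead : ∀ δ a → I (decLast (incHead (δ ++ [ suc a ]))) ≡ map suc (I (δ ++ [ suc a ]))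
I-decLast-incHead []       a = refl
I-decLast-incHead (z ∷ zs) a = begin
  I (decLast ((suc z ∷ zs) ++ [ suc a ]))          ≡⟨ cong I (decLast-∷ʳ (suc z ∷ zs) (suc a)) ⟩
  I ((suc z ∷ zs) ++ [ a ])                        ≡⟨ I-∷ʳ (suc z ∷ zs) a (s≤s z≤n) ⟩
  I (suc z ∷ zs) ++ [ suc (sum (z ∷ zs)) ]         ≡⟨ cong (_++ [ suc (sum (z ∷ zs)) ]) (I-incHead (z ∷ zs)) ⟩
  map suc (I (z ∷ zs)) ++ [ suc (sum (z ∷ zs)) ]   ≡⟨ map-++ suc (I (z ∷ zs)) [ sum (z ∷ zs) ] ⟨
  map suc (I (z ∷ zs) ++ [ sum (z ∷ zs) ])         ≡⟨ cong (map suc) (I-∷ʳ (z ∷ zs) (suc a) (s≤s z≤n)) ⟨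
  map suc (I ((z ∷ zs) ++ [ suc a ]))              ∎
  where open ≡-Reasoning

sum-decLast-incHead : ∀ δ a → sum (decLast (incHead (δ ++ [ suc a ]))) ≡ sum (δ ++ [ suc a ])
sum-decLast-incHead []       a = refl
sum-decLast-incHead (z ∷ zs) a = begin
  sum (decLast ((suc z ∷ zs) ++ [ suc a ]))  ≡⟨ cong sum (decLast-∷ʳ (suc z ∷ zs) (suc a)) ⟩
  sum ((suc z ∷ zs) ++ [ a ])                ≡⟨ sum-++ (suc z ∷ zs) [ a ] ⟩
  suc (sum (z ∷ zs)) + (a + 0)               ≡⟨ +-suc (sum (z ∷ zs)) (a + 0) ⟨
  sum (z ∷ zs) + sum [ suc a ]               ≡⟨ sum-++ (z ∷ zs) [ suc a ] ⟨
  sum ((z ∷ zs) ++ [ suc a ])                ∎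
  where open ≡-Reasoning

I-flat : ∀ a as → I (flat (suc a ∷ as)) ≡ map suc (I (reverse (suc a ∷ as)))
I-flat a as = begin
  I (decLast (incHead (reverse (suc a ∷ as))))        ≡⟨ cong (I ∘ decLast ∘ incHead) (unfold-reverse (suc a) as) ⟩
  I (decLast (incHead (reverse as ++ [ suc a ])))     ≡⟨ I-decLast-incHead (reverse as) a ⟩
  map suc (I (reverse as ++ [ suc a ]))               ≡⟨ cong (map suc ∘ I) (unfold-reverse (suc a) as) ⟨
  map suc (I (reverse (suc a ∷ as)))                  ∎
  where open ≡-Reasoning

sum-flat : ∀ a as → sum (flat (suc a ∷ as)) ≡ sum (suc a ∷ as)
sum-flat a as = begin
  sum (decLast (incHead (reverse (suc a ∷ as))))      ≡⟨ cong (sum ∘ decLast ∘ incHead) (unfold-reverse (suc a) as) ⟩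
  sum (decLast (incHead (reverse as ++ [ suc a ])))   ≡⟨ sum-decLast-incHead (reverse as) a ⟩
  sum (reverse as ++ [ suc a ])                       ≡⟨ cong sum (unfold-reverse (suc a) as) ⟨
  sum (reverse (suc a ∷ as))                          ≡⟨ sum-reverse (suc a ∷ as) ⟩
  sum (suc a ∷ as)                                    ∎
  where open ≡-Reasoning

peak-reverse : ∀ a as γ → sum γ ≡ sum (suc a ∷ as) →
               I (suc a ∷ as) ⊆ᵇ I⁺ γ ≡ I (flat (suc a ∷ as)) ⊆ᵇ I⁺ (reverse γ)
peak-reverse a as γ eq = begin
  I α ⊆ᵇ I⁺ γ                                ≡⟨ cong (λ δ → I α ⊆ᵇ I⁺ δ) (reverse-involutive γ) ⟨
  I α ⊆ᵇ I⁺ (reverse (reverse γ))            ≡⟨ ⊆ᵇ-I⁺-reverse α (reverse γ) (trans (sum-reverse γ) eq) ⟩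
  map suc (I (reverse α)) ⊆ᵇ I⁺ (reverse γ)  ≡⟨ cong (_⊆ᵇ I⁺ (reverse γ)) (I-flat a as) ⟨
  I (flat α) ⊆ᵇ I⁺ (reverse γ)               ∎
  where
  open ≡-Reasoning
  α = suc a ∷ as

-- Compositions as binary words

-- The word w₁⋯wₙ encodes the composition γ of n + 1 with i ∈ I(γ) iff wᵢ = true.
firstPart  : Vec Bool n → ℕ
laterParts : Vec Bool n → List ℕ

toComposition : Vec Bool n → List ℕ
toComposition w = firstPart w ∷ laterParts w

firstPart []          = 1
firstPart (true ∷ w)  = 1
firstPart (false ∷ w) = suc (firstPart w)

laterParts []          = []
laterParts (true ∷ w)  = toComposition w
laterParts (false ∷ w) = laterParts w

words : (n : ℕ) → List (Vec Bool n)
words zero    = [ [] ]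
words (suc n) = concatMap (λ w → (true ∷ w) ∷ (false ∷ w) ∷ []) (words n)

compsSuc≡map-toComposition : ∀ n → compsSuc n ≡ map toComposition (words n)
compsSuc≡map-toComposition zero    = refl
compsSuc≡map-toComposition (suc n) = begin
  concatMap extend (compsSuc n)                     ≡⟨ cong (concatMap extend) (compsSuc≡map-toComposition n) ⟩
  concatMap extend (map toComposition (words n))    ≡⟨ concatMap-map extend toComposition (words n) ⟩
  concatMap (map toComposition ∘ extendʷ) (words n) ≡⟨ map-concatMap toComposition extendʷ (words n) ⟨
  map toComposition (concatMap extendʷ (words n))   ∎
  where
  open ≡-Reasoning
  extend : List ℕ → List (List ℕ)
  extend γ = (1 ∷ γ) ∷ incHead γ ∷ []
  extendʷ : Vec Bool n → List (Vec Bool (suc n))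
  extendʷ w = (true ∷ w) ∷ (false ∷ w) ∷ []

concatMap-compositions : ∀ n {b} {B : Set b} (h : List ℕ → List B) →
                         concatMap h (compositions (suc n)) ≡ concatMap (h ∘ toComposition) (words n)
concatMap-compositions n h =
  trans (cong (concatMap h) (compsSuc≡map-toComposition n)) (concatMap-map h toComposition (words n))

sum-toComposition : (w : Vec Bool n) → sum (toComposition w) ≡ suc n
sum-toComposition []          = refl
sum-toComposition (true ∷ w)  = cong suc (sum-toComposition w)
sum-toComposition (false ∷ w) = cong suc (sum-toComposition w)

toComposition-isComposition : (w : Vec Bool n) → IsComposition (toComposition w)
toComposition-isComposition []          = s≤s z≤n ∷ []
toComposition-isComposition (true ∷ w)  = s≤s z≤n ∷ toComposition-isComposition w
toComposition-isComposition (false ∷ w) with toComposition-isComposition w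
... | _ ∷ parts = s≤s z≤n ∷ parts

I-toComposition-positive : (w : Vec Bool n) → All (1 ≤_) (I (toComposition w))
I-toComposition-positive w = I-positive (toComposition-isComposition w)

_≟ʷ_ : (w v : Vec Bool n) → Dec (w ≡ v)
_≟ʷ_ = Vec.≡-dec _≟ᵇ_

_⊑_ : Vec Bool n → Vec Bool n → Bool
[]      ⊑ []      = true
(a ∷ w) ⊑ (b ∷ v) = (not a ∨ b) ∧ (w ⊑ v)

⊆ᵇ-toComposition : (w v : Vec Bool n) → I (toComposition w) ⊆ᵇ I (toComposition v) ≡ w ⊑ v
⊆ᵇ-toComposition []          []          = refl
⊆ᵇ-toComposition (true ∷ w)  (true ∷ v)  =
  trans (map-suc-⊆ᵇ-1∷map-suc (I (toComposition v)) (I-toComposition-positive w)) (⊆ᵇ-toComposition w v)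
⊆ᵇ-toComposition (true ∷ w)  (false ∷ v)
  rewrite I-incHead (toComposition v)
        | suc-∈ᵇ-map-suc 0 (I (toComposition v))
        | 0-∉ᵇ-positive (I-toComposition-positive v) = refl
⊆ᵇ-toComposition (false ∷ w) (true ∷ v)
  rewrite I-incHead (toComposition w) =
  trans (map-suc-⊆ᵇ-1∷map-suc (I (toComposition v)) (I-toComposition-positive w)) (⊆ᵇ-toComposition w v)
⊆ᵇ-toComposition (false ∷ w) (false ∷ v)
  rewrite I-incHead (toComposition w) | I-incHead (toComposition v) =
  trans (map-suc-⊆ᵇ-map-suc (I (toComposition w)) (I (toComposition v))) (⊆ᵇ-toComposition w v)

⊑-refl : (w : Vec Bool n) → w ⊑ w ≡ true
⊑-refl []          = refl
⊑-refl (true ∷ w)  = ⊑-refl w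
⊑-refl (false ∷ w) = ⊑-refl w

⊑-∷ʳ : (w v : Vec Bool n) (a b : Bool) → (w ∷ʳ a) ⊑ (v ∷ʳ b) ≡ (w ⊑ v) ∧ (not a ∨ b)
⊑-∷ʳ []      []      a b = ∧-comm (not a ∨ b) true
⊑-∷ʳ (c ∷ w) (d ∷ v) a b =
  trans (cong ((not c ∨ d) ∧_) (⊑-∷ʳ w v a b)) (sym (∧-assoc (not c ∨ d) (w ⊑ v) (not a ∨ b)))

⊑-reverse : (w v : Vec Bool n) → Vec.reverse w ⊑ Vec.reverse v ≡ w ⊑ v
⊑-reverse []      []      = refl
⊑-reverse (a ∷ w) (b ∷ v) = begin
  Vec.reverse (a ∷ w) ⊑ Vec.reverse (b ∷ v)      ≡⟨ cong₂ _⊑_ (Vec.reverse-∷ a w) (Vec.reverse-∷ b v) ⟩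
  (Vec.reverse w ∷ʳ a) ⊑ (Vec.reverse v ∷ʳ b)    ≡⟨ ⊑-∷ʳ (Vec.reverse w) (Vec.reverse v) a b ⟩
  (Vec.reverse w ⊑ Vec.reverse v) ∧ (not a ∨ b)  ≡⟨ cong (_∧ (not a ∨ b)) (⊑-reverse w v) ⟩
  (w ⊑ v) ∧ (not a ∨ b)                          ≡⟨ ∧-comm (w ⊑ v) (not a ∨ b) ⟩
  (not a ∨ b) ∧ (w ⊑ v)                          ∎
  where open ≡-Reasoning

falses : Vec Bool n → ℕ
falses []          = 0
falses (true ∷ w)  = falses w
falses (false ∷ w) = suc (falses w)

⊑⇒falses-≤ : (w v : Vec Bool n) → w ⊑ v ≡ true → falses v ≤ falses w
⊑⇒falses-≤ []          []          _  = z≤n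
⊑⇒falses-≤ (true ∷ w)  (true ∷ v)  w⊑v = ⊑⇒falses-≤ w v w⊑v
⊑⇒falses-≤ (false ∷ w) (true ∷ v)  w⊑v = m≤n⇒m≤1+n (⊑⇒falses-≤ w v w⊑v)
⊑⇒falses-≤ (false ∷ w) (false ∷ v) w⊑v = s≤s (⊑⇒falses-≤ w v w⊑v)

⊏⇒falses-< : (w v : Vec Bool n) → w ⊑ v ≡ true → w ≢ v → falses v < falses w
⊏⇒falses-< []          []          _   w≢v = ⊥-elim (w≢v refl)
⊏⇒falses-< (true ∷ w)  (true ∷ v)  w⊑v w≢v = ⊏⇒falses-< w v w⊑v (w≢v ∘ cong (true ∷_))
⊏⇒falses-< (false ∷ w) (true ∷ v)  w⊑v _   = s≤s (⊑⇒falses-≤ w v w⊑v)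
⊏⇒falses-< (false ∷ w) (false ∷ v) w⊑v w≢v = s≤s (⊏⇒falses-< w v w⊑v (w≢v ∘ cong (false ∷_)))

incLast : List ℕ → List ℕ
incLast []           = []
incLast (x ∷ [])     = suc x ∷ []
incLast (x ∷ y ∷ ys) = x ∷ incLast (y ∷ ys)

incLast-∷ʳ : ∀ δ x → incLast (δ ++ [ x ]) ≡ δ ++ [ suc x ]
incLast-∷ʳ []           x = refl
incLast-∷ʳ (z ∷ [])     x = refl
incLast-∷ʳ (z ∷ y ∷ ys) x = cong (z ∷_) (incLast-∷ʳ (y ∷ ys) x)

reverse-incHead : ∀ γ → reverse (incHead γ) ≡ incLast (reverse γ)
reverse-incHead []       = refl
reverse-incHead (x ∷ xs) = begin
  reverse (suc x ∷ xs)        ≡⟨ unfold-reverse (suc x) xs ⟩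
  reverse xs ++ [ suc x ]     ≡⟨ incLast-∷ʳ (reverse xs) x ⟨
  incLast (reverse xs ++ [ x ]) ≡⟨ cong incLast (unfold-reverse x xs) ⟨
  incLast (reverse (x ∷ xs))  ∎
  where open ≡-Reasoning

incHead-incLast : ∀ γ → incHead (incLast γ) ≡ incLast (incHead γ)
incHead-incLast []           = refl
incHead-incLast (x ∷ [])     = refl
incHead-incLast (x ∷ y ∷ ys) = refl

toComposition-∷ʳ-true : (w : Vec Bool n) → toComposition (w ∷ʳ true) ≡ toComposition w ++ [ 1 ]
toComposition-∷ʳ-true []          = refl
toComposition-∷ʳ-true (true ∷ w)  = cong (1 ∷_) (toComposition-∷ʳ-true w)
toComposition-∷ʳ-true (false ∷ w) = cong incHead (toComposition-∷ʳ-true w)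

toComposition-∷ʳ-false : (w : Vec Bool n) → toComposition (w ∷ʳ false) ≡ incLast (toComposition w)
toComposition-∷ʳ-false []          = refl
toComposition-∷ʳ-false (true ∷ w)  = cong (1 ∷_) (toComposition-∷ʳ-false w)
toComposition-∷ʳ-false (false ∷ w) =
  trans (cong incHead (toComposition-∷ʳ-false w)) (incHead-incLast (toComposition w))

reverse-toComposition : (w : Vec Bool n) → reverse (toComposition w) ≡ toComposition (Vec.reverse w)
reverse-toComposition []          = refl
reverse-toComposition (true ∷ w)  = begin
  reverse (1 ∷ toComposition w)                 ≡⟨ unfold-reverse 1 (toComposition w) ⟩
  reverse (toComposition w) ++ [ 1 ]            ≡⟨ cong (_++ [ 1 ]) (reverse-toComposition w) ⟩
  toComposition (Vec.reverse w) ++ [ 1 ]        ≡⟨ toComposition-∷ʳ-true (Vec.reverse w) ⟨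
  toComposition (Vec.reverse w ∷ʳ true)         ≡⟨ cong toComposition (Vec.reverse-∷ true w) ⟨
  toComposition (Vec.reverse (true ∷ w))        ∎
  where open ≡-Reasoning
reverse-toComposition (false ∷ w) = begin
  reverse (incHead (toComposition w))           ≡⟨ reverse-incHead (toComposition w) ⟩
  incLast (reverse (toComposition w))           ≡⟨ cong incLast (reverse-toComposition w) ⟩
  incLast (toComposition (Vec.reverse w))       ≡⟨ toComposition-∷ʳ-false (Vec.reverse w) ⟨
  toComposition (Vec.reverse w ∷ʳ false)        ≡⟨ cong toComposition (Vec.reverse-∷ false w) ⟨
  toComposition (Vec.reverse (false ∷ w))       ∎
  where open ≡-Reasoning

-- Quasisymmetric functions in the monomial basis

module _ {c ℓ} (F : Field c ℓ) where
  open Field F renaming (_+_ to _+ᶠ_; _*_ to _*ᶠ_; refl to ≈-refl; sym to ≈-sym; trans to ≈-trans)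
  open QSymOver F
  open RingProperties ring using (+-cancelʳ)
  open CommutativeSemigroupProperties +-commutativeSemigroup using (interchange)
  module ≈-Reasoning = SetoidReasoning setoid

  ≋-setoid : Setoid c ℓ
  ≋-setoid = record
    { Carrier       = QSym
    ; _≈_           = _≋_
    ; isEquivalence = record
      { refl  = λ _ → ≈-refl
      ; sym   = λ f≋g γ → ≈-sym (f≋g γ)
      ; trans = λ f≋g g≋h γ → ≈-trans (f≋g γ) (g≋h γ)
      }
    }

  module ≋ = Setoid ≋-setoid
  module ≋-Reasoning = SetoidReasoning ≋-setoid

  ≡⇒≋ : ∀ {f g} → f ≡ g → f ≋ g
  ≡⇒≋ refl _ = ≈-refl

  ∑ : {A : Set} → List A → (A → Carrier) → Carrier
  ∑ []       t = 0#
  ∑ (x ∷ xs) t = t x +ᶠ ∑ xs t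

  ∑-cong : {A : Set} (xs : List A) {s t : A → Carrier} → (∀ x → s x ≈ t x) → ∑ xs s ≈ ∑ xs t
  ∑-cong []       _   = ≈-refl
  ∑-cong (x ∷ xs) s≈t = +-cong (s≈t x) (∑-cong xs s≈t)

  ∑-+ : {A : Set} (xs : List A) (s t : A → Carrier) → ∑ xs (λ x → s x +ᶠ t x) ≈ ∑ xs s +ᶠ ∑ xs t
  ∑-+ []       s t = ≈-sym (+-identityˡ 0#)
  ∑-+ (x ∷ xs) s t = ≈-trans (+-congˡ (∑-+ xs s t)) (interchange (s x) (t x) (∑ xs s) (∑ xs t))

  ∑-++ : {A : Set} (xs ys : List A) (t : A → Carrier) → ∑ (xs ++ ys) t ≈ ∑ xs t +ᶠ ∑ ys t
  ∑-++ []       ys t = ≈-sym (+-identityˡ _)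
  ∑-++ (x ∷ xs) ys t = ≈-trans (+-congˡ (∑-++ xs ys t)) (≈-sym (+-assoc _ _ _))

  ∑-concatMap : {A B : Set} (h : A → List B) (xs : List A) (t : B → Carrier) →
                ∑ (concatMap h xs) t ≈ ∑ xs (λ x → ∑ (h x) t)
  ∑-concatMap h []       t = ≈-refl
  ∑-concatMap h (x ∷ xs) t = ≈-trans (∑-++ (h x) (concatMap h xs) t) (+-congˡ (∑-concatMap h xs t))

  ∑-words-suc : ∀ n (t : Vec Bool (suc n) → Carrier) →
                ∑ (words (suc n)) t ≈ ∑ (words n) (λ v → t (true ∷ v) +ᶠ t (false ∷ v))
  ∑-words-suc n t = ≈-trans (∑-concatMap _ (words n) t) (∑-cong (words n) (λ v → +-congˡ (+-identityʳ _)))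

  ∑-words-∷ʳ : ∀ n (t : Vec Bool (suc n) → Carrier) →
               ∑ (words (suc n)) t ≈ ∑ (words n) (λ v → t (v ∷ʳ true) +ᶠ t (v ∷ʳ false))
  ∑-words-∷ʳ zero    t = ≈-trans (+-congˡ (+-identityʳ _)) (≈-sym (+-identityʳ _))
  ∑-words-∷ʳ (suc n) t = begin
    ∑ (words (suc (suc n))) t                                  ≈⟨ ∑-words-suc (suc n) t ⟩
    ∑ (words (suc n)) byHead                                   ≈⟨ ∑-words-∷ʳ n byHead ⟩
    ∑ (words n) (λ u → byHead (u ∷ʳ true) +ᶠ byHead (u ∷ʳ false))
      ≈⟨ ∑-cong (words n) (λ u → interchange _ _ _ _) ⟩
    ∑ (words n) (λ u → byLast (true ∷ u) +ᶠ byLast (false ∷ u))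
      ≈⟨ ∑-words-suc n byLast ⟨
    ∑ (words (suc n)) byLast                                   ∎
    where
    open ≈-Reasoning
    byHead byLast : Vec Bool (suc n) → Carrier
    byHead v = t (true ∷ v) +ᶠ t (false ∷ v)
    byLast v = t (v ∷ʳ true) +ᶠ t (v ∷ʳ false)

  ∑-words-reverse : ∀ n (t : Vec Bool n → Carrier) → ∑ (words n) (t ∘ Vec.reverse) ≈ ∑ (words n) t
  ∑-words-reverse zero    t = ≈-refl
  ∑-words-reverse (suc n) t = begin
    ∑ (words (suc n)) (t ∘ Vec.reverse)
      ≈⟨ ∑-words-suc n (t ∘ Vec.reverse) ⟩
    ∑ (words n) (λ v → t (Vec.reverse (true ∷ v)) +ᶠ t (Vec.reverse (false ∷ v)))
      ≈⟨ ∑-cong (words n) (λ v → reflexive (cong₂ _+ᶠ_ (cong t (Vec.reverse-∷ true v))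
                                                        (cong t (Vec.reverse-∷ false v)))) ⟩
    ∑ (words n) (byLast ∘ Vec.reverse)
      ≈⟨ ∑-words-reverse n byLast ⟩
    ∑ (words n) byLast
      ≈⟨ ∑-words-∷ʳ n t ⟨
    ∑ (words (suc n)) t ∎
    where
    open ≈-Reasoning
    byLast : Vec Bool n → Carrier
    byLast u = t (u ∷ʳ true) +ᶠ t (u ∷ʳ false)

  ∑-words-δ : ∀ n (w : Vec Bool n) (t : Vec Bool n → Carrier) →
              ∑ (words n) (λ v → if does (w ≟ʷ v) then t v else 0#) ≈ t w
  ∑-words-δ zero    []          t = +-identityʳ _
  ∑-words-δ (suc n) (true ∷ w)  t = ≈-trans (∑-words-suc n _)
    (≈-trans (∑-cong (words n) (λ _ → +-identityʳ _)) (∑-words-δ n w (t ∘ (true ∷_))))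
  ∑-words-δ (suc n) (false ∷ w) t = ≈-trans (∑-words-suc n _)
    (≈-trans (∑-cong (words n) (λ _ → +-identityˡ _)) (∑-words-δ n w (t ∘ (false ∷_))))

  coeff-⊕ : ∀ f g γ → coeff (f ⊕ g) γ ≈ coeff f γ +ᶠ coeff g γ
  coeff-⊕ []            g γ = ≈-sym (+-identityˡ _)
  coeff-⊕ ((a , δ) ∷ f) g γ = ≈-trans (+-congˡ (coeff-⊕ f g γ)) (≈-sym (+-assoc _ _ _))

  coeff-· : ∀ a f γ → coeff (a · f) γ ≈ a *ᶠ coeff f γ
  coeff-· a []            γ = ≈-sym (zeroʳ a)
  coeff-· a ((b , δ) ∷ f) γ with does (≡-dec _≟_ δ γ)
  ... | true  = ≈-trans (+-congˡ (coeff-· a f γ)) (≈-sym (distribˡ a b (coeff f γ)))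
  ... | false = ≈-trans (+-congˡ (coeff-· a f γ)) (≈-trans (+-identityˡ _) (≈-sym (*-congˡ (+-identityˡ _))))

  coeff-if : ∀ b f γ → coeff (if b then f else []) γ ≈ (if b then coeff f γ else 0#)
  coeff-if true  f γ = ≈-refl
  coeff-if false f γ = ≈-refl

  coeff-concatMap : {A : Set} (h : A → QSym) (xs : List A) (γ : List ℕ) →
                    coeff (concatMap h xs) γ ≈ ∑ xs (λ x → coeff (h x) γ)
  coeff-concatMap h []       γ = ≈-refl
  coeff-concatMap h (x ∷ xs) γ = ≈-trans (coeff-⊕ (h x) (concatMap h xs) γ) (+-congˡ (coeff-concatMap h xs γ))

  ⊕-cong : ∀ {f f′ g g′} → f ≋ f′ → g ≋ g′ → f ⊕ g ≋ f′ ⊕ g′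
  ⊕-cong {f} {f′} {g} {g′} f≋f′ g≋g′ γ =
    ≈-trans (coeff-⊕ f g γ) (≈-trans (+-cong (f≋f′ γ) (g≋g′ γ)) (≈-sym (coeff-⊕ f′ g′ γ)))

  ·-cong : ∀ a {f g} → f ≋ g → a · f ≋ a · g
  ·-cong a {f} {g} f≋g γ = ≈-trans (coeff-· a f γ) (≈-trans (*-congˡ (f≋g γ)) (≈-sym (coeff-· a g γ)))

  singleton-cong : ∀ {a b} γ → a ≈ b → [ (a , γ) ] ≋ [ (b , γ) ]
  singleton-cong γ a≈b δ with does (≡-dec _≟_ γ δ)
  ... | true  = +-congʳ a≈b
  ... | false = ≈-refl

  ⊕-cancelʳ : ∀ {f g} h → f ⊕ h ≋ g ⊕ h → f ≋ g
  ⊕-cancelʳ {f} {g} h eq γ = +-cancelʳ (coeff h γ) (coeff f γ) (coeff g γ)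
    (≈-trans (≈-sym (coeff-⊕ f h γ)) (≈-trans (eq γ) (coeff-⊕ g h γ)))

  concatMap-cong-≋ : {A : Set} {h h′ : A → QSym} (xs : List A) → (∀ x → h x ≋ h′ x) →
                     concatMap h xs ≋ concatMap h′ xs
  concatMap-cong-≋ {h = h} {h′} xs h≋h′ γ = ≈-trans (coeff-concatMap h xs γ)
    (≈-trans (∑-cong xs (λ x → h≋h′ x γ)) (≈-sym (coeff-concatMap h′ xs γ)))

  concatMap-⊕ : {A : Set} (h h′ : A → QSym) (xs : List A) →
                concatMap (λ x → h x ⊕ h′ x) xs ≋ concatMap h xs ⊕ concatMap h′ xs
  concatMap-⊕ h h′ xs γ = begin
    coeff (concatMap (λ x → h x ⊕ h′ x) xs) γ
      ≈⟨ coeff-concatMap _ xs γ ⟩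
    ∑ xs (λ x → coeff (h x ⊕ h′ x) γ)
      ≈⟨ ∑-cong xs (λ x → coeff-⊕ (h x) (h′ x) γ) ⟩
    ∑ xs (λ x → coeff (h x) γ +ᶠ coeff (h′ x) γ)
      ≈⟨ ∑-+ xs _ _ ⟩
    ∑ xs (λ x → coeff (h x) γ) +ᶠ ∑ xs (λ x → coeff (h′ x) γ)
      ≈⟨ +-cong (coeff-concatMap h xs γ) (coeff-concatMap h′ xs γ) ⟨
    coeff (concatMap h xs) γ +ᶠ coeff (concatMap h′ xs) γ
      ≈⟨ coeff-⊕ (concatMap h xs) (concatMap h′ xs) γ ⟨
    coeff (concatMap h xs ⊕ concatMap h′ xs) γ ∎
    where open ≈-Reasoning

  concatMap-words-reverse : ∀ n (h : Vec Bool n → QSym) →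
                            concatMap (h ∘ Vec.reverse) (words n) ≋ concatMap h (words n)
  concatMap-words-reverse n h γ = ≈-trans (coeff-concatMap (h ∘ Vec.reverse) (words n) γ)
    (≈-trans (∑-words-reverse n (λ v → coeff (h v) γ)) (≈-sym (coeff-concatMap h (words n) γ)))

  concatMap-words-δ : ∀ n (w : Vec Bool n) (h : Vec Bool n → QSym) →
                      concatMap (λ v → if does (w ≟ʷ v) then h v else []) (words n) ≋ h w
  concatMap-words-δ n w h γ = ≈-trans (coeff-concatMap _ (words n) γ)
    (≈-trans (∑-cong (words n) (λ v → coeff-if (does (w ≟ʷ v)) (h v) γ))
           (∑-words-δ n w (λ v → coeff (h v) γ)))

  ρ : QSym → QSym
  ρ = map (map₂ reverse)

  coeff-ρ : ∀ f γ → coeff (ρ f) γ ≈ coeff f (reverse γ)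
  coeff-ρ []            γ = ≈-refl
  coeff-ρ ((a , δ) ∷ f) γ = +-cong (reflexive (cong (if_then a else 0#) same-test)) (coeff-ρ f γ)
    where
    same-test : does (≡-dec _≟_ (reverse δ) γ) ≡ does (≡-dec _≟_ δ (reverse γ))
    same-test = does-⇔ (mk⇔ (λ e → trans (sym (reverse-involutive δ)) (cong reverse e))
                            (λ e → trans (cong reverse e) (reverse-involutive γ)))
                       (≡-dec _≟_ (reverse δ) γ) (≡-dec _≟_ δ (reverse γ))

  ρ-cong : ∀ {f g} → f ≋ g → ρ f ≋ ρ g
  ρ-cong {f} {g} f≋g γ = ≈-trans (coeff-ρ f γ) (≈-trans (f≋g (reverse γ)) (≈-sym (coeff-ρ g γ)))

  ρ-⊕ : ∀ f g → ρ (f ⊕ g) ≡ ρ f ⊕ ρ g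
  ρ-⊕ f g = map-++ (map₂ reverse) f g

  ρ-if : ∀ b f → ρ (if b then f else []) ≡ (if b then ρ f else [])
  ρ-if true  f = refl
  ρ-if false f = refl

  L-toComposition : (w : Vec Bool n) →
                    L (toComposition w) ≡ concatMap (λ v → if w ⊑ v then M (toComposition v) else []) (words n)
  L-toComposition {n} w = begin
    concatMap lTerm (compositions (sum (toComposition w)))  ≡⟨ cong (concatMap lTerm ∘ compositions) (sum-toComposition w) ⟩
    concatMap lTerm (compositions (suc n))                  ≡⟨ concatMap-compositions n lTerm ⟩
    concatMap (lTerm ∘ toComposition) (words n)             ≡⟨ concatMap-cong ⊆ᵇ-as-⊑ (words n) ⟩
    concatMap (λ v → if w ⊑ v then M (toComposition v) else []) (words n) ∎
    where
    open ≡-Reasoning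
    lTerm : List ℕ → QSym
    lTerm γ = if I (toComposition w) ⊆ᵇ I γ then M γ else []
    ⊆ᵇ-as-⊑ : ∀ v → lTerm (toComposition v) ≡ (if w ⊑ v then M (toComposition v) else [])
    ⊆ᵇ-as-⊑ v = cong (if_then M (toComposition v) else []) (⊆ᵇ-toComposition w v)

  ρ-L-toComposition : (w : Vec Bool n) → ρ (L (toComposition w)) ≋ L (reverse (toComposition w))
  ρ-L-toComposition {n} w = begin
    ρ (L (toComposition w))
      ≡⟨ cong ρ (L-toComposition w) ⟩
    ρ (concatMap (λ v → if w ⊑ v then M (toComposition v) else []) (words n))
      ≡⟨ map-concatMap (map₂ reverse) _ (words n) ⟩
    concatMap (λ v → ρ (if w ⊑ v then M (toComposition v) else [])) (words n)
      ≡⟨ concatMap-cong reverse-term (words n) ⟩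
    concatMap (term ∘ Vec.reverse) (words n)
      ≈⟨ concatMap-words-reverse n term ⟩
    concatMap term (words n)
      ≡⟨ L-toComposition (Vec.reverse w) ⟨
    L (toComposition (Vec.reverse w))
      ≡⟨ cong L (reverse-toComposition w) ⟨
    L (reverse (toComposition w))   ∎
    where
    open ≋-Reasoning
    term : Vec Bool n → QSym
    term v = if Vec.reverse w ⊑ v then M (toComposition v) else []
    reverse-term : ∀ v → ρ (if w ⊑ v then M (toComposition v) else []) ≡ term (Vec.reverse v)
    reverse-term v = trans (ρ-if (w ⊑ v) (M (toComposition v)))
      (cong₂ (λ b γ → if b then M γ else []) (sym (⊑-reverse w v)) (reverse-toComposition v))

  strictRefinements : Vec Bool n → QSym
  strictRefinements {n} w =
    concatMap (λ v → if (w ⊑ v) ∧ not (does (w ≟ʷ v)) then M (toComposition v) else []) (words n)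

  L-toComposition-split : (w : Vec Bool n) → L (toComposition w) ≋ M (toComposition w) ⊕ strictRefinements w
  L-toComposition-split {n} w = begin
    L (toComposition w)
      ≡⟨ L-toComposition w ⟩
    concatMap (λ v → if w ⊑ v then m v else []) (words n)
      ≈⟨ concatMap-cong-≋ (words n) split-at ⟩
    concatMap (λ v → diagonal v ⊕ strict v) (words n)
      ≈⟨ concatMap-⊕ diagonal strict (words n) ⟩
    concatMap diagonal (words n) ⊕ strictRefinements w
      ≈⟨ ⊕-cong {concatMap diagonal (words n)} {m w} {strictRefinements w} {strictRefinements w}
                (concatMap-words-δ n w m) (λ _ → ≈-refl) ⟩
    M (toComposition w) ⊕ strictRefinements w ∎
    where
    open ≋-Reasoning
    m diagonal strict : Vec Bool n → QSym
    m v        = M (toComposition v)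
    diagonal v = if does (w ≟ʷ v) then m v else []
    strict v   = if (w ⊑ v) ∧ not (does (w ≟ʷ v)) then m v else []
    split-at : ∀ v → (if w ⊑ v then m v else []) ≋ diagonal v ⊕ strict v
    split-at v with w ≟ʷ v
    ... | yes refl rewrite ⊑-refl w = ≡⇒≋ (sym (++-identityʳ (m v)))
    ... | no _ with w ⊑ v
    ...   | true  = λ _ → ≈-refl
    ...   | false = λ _ → ≈-refl

  kTerm : List ℕ → List ℕ → QSym
  kTerm α γ = if I α ⊆ᵇ I⁺ γ then [ (two^ (length γ) , γ) ] else []

  ρ-kTerm : ∀ a as γ → sum γ ≡ sum (suc a ∷ as) →
            ρ (kTerm (suc a ∷ as) γ) ≡ kTerm (flat (suc a ∷ as)) (reverse γ)
  ρ-kTerm a as γ eq = trans (ρ-if _ [ (two^ (length γ) , γ) ])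
    (cong₂ (λ b k → if b then [ (k , reverse γ) ] else [])
             (peak-reverse a as γ eq) (cong two^ (sym (length-reverse γ))))

  ρ-K : ∀ a as → ρ (K (suc a ∷ as)) ≋ K (flat (suc a ∷ as))
  ρ-K a as = begin
    ρ (concatMap (kTerm α) (compositions (suc N)))
      ≡⟨ cong ρ (concatMap-compositions N (kTerm α)) ⟩
    ρ (concatMap (kTerm α ∘ toComposition) (words N))
      ≡⟨ map-concatMap (map₂ reverse) (kTerm α ∘ toComposition) (words N) ⟩
    concatMap (ρ ∘ kTerm α ∘ toComposition) (words N)
      ≡⟨ concatMap-cong reverse-term (words N) ⟩
    concatMap (kTerm α♭ ∘ toComposition ∘ Vec.reverse) (words N)
      ≈⟨ concatMap-words-reverse N (kTerm α♭ ∘ toComposition) ⟩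
    concatMap (kTerm α♭ ∘ toComposition) (words N)
      ≡⟨ concatMap-compositions N (kTerm α♭) ⟨
    concatMap (kTerm α♭) (compositions (suc N))
      ≡⟨ cong (concatMap (kTerm α♭) ∘ compositions) (sum-flat a as) ⟨
    K α♭ ∎
    where
    open ≋-Reasoning
    α  = suc a ∷ as
    α♭ = flat α
    N  = a + sum as
    reverse-term : ∀ v → ρ (kTerm α (toComposition v)) ≡ kTerm α♭ (toComposition (Vec.reverse v))
    reverse-term v = trans (ρ-kTerm a as (toComposition v) (sum-toComposition v))
                             (cong (kTerm α♭) (reverse-toComposition v))

  module _ (φ : QSym → QSym) (linear : IsLinear φ) where
    open IsLinear linear

    Reverses : List ℕ → Set ℓ
    Reverses γ = φ (M γ) ≋ M (reverse γ)

    φ-[] : φ [] ≋ []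
    φ-[] γ = ≈-trans (homogeneous 0# [] γ) (≈-trans (coeff-· 0# (φ []) γ) (zeroˡ _))

    φ-singleton : ∀ a γ → Reverses γ → φ [ (a , γ) ] ≋ ρ [ (a , γ) ]
    φ-singleton a γ φMγ≋Mγʳ = begin
      φ [ (a , γ) ]         ≈⟨ cong-≋ [ (a , γ) ] (a · M γ) (singleton-cong γ (≈-sym (*-identityʳ a))) ⟩
      φ (a · M γ)           ≈⟨ homogeneous a (M γ) ⟩
      a · φ (M γ)           ≈⟨ ·-cong a {φ (M γ)} {M (reverse γ)} φMγ≋Mγʳ ⟩
      a · M (reverse γ)     ≈⟨ singleton-cong (reverse γ) (*-identityʳ a) ⟩
      [ (a , reverse γ) ]   ∎
      where open ≋-Reasoning

    φ≋ρ : ∀ f → All (Reverses ∘ proj₂) f → φ f ≋ ρ f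
    φ≋ρ []      []       = φ-[]
    φ≋ρ (x ∷ f) (r ∷ rs) = λ γ → ≈-trans (additive [ x ] f γ)
      (⊕-cong {φ [ x ]} {ρ [ x ]} {φ f} {ρ f} (φ-singleton _ _ r) (φ≋ρ f rs) γ)

    module _ (hyp : ∀ (β : List ℕ) → IsComposition β → φ (L β) ≋ L (reverse β)) where

      -- φ and ρ agree on L_γ and, inductively, on its strictly finer part; cancel the latter.
      reverses-step : (w : Vec Bool n) → (∀ v → falses v < falses w → Reverses (toComposition v)) →
                      Reverses (toComposition w)
      reverses-step {n} w IH = ⊕-cancelʳ {φ Mw} {M (reverse γ)} (φ R) (begin
        φ Mw ⊕ φ R                ≈⟨ additive Mw R ⟨
        φ (Mw ⊕ R)                ≈⟨ cong-≋ (Mw ⊕ R) (L γ) (≋.sym {L γ} {Mw ⊕ R} split) ⟩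
        φ (L γ)                   ≈⟨ hyp γ (toComposition-isComposition w) ⟩
        L (reverse γ)             ≈⟨ ρ-L-toComposition w ⟨
        ρ (L γ)                   ≈⟨ ρ-cong {L γ} {Mw ⊕ R} split ⟩
        ρ (Mw ⊕ R)                ≡⟨ ρ-⊕ Mw R ⟩
        M (reverse γ) ⊕ ρ R       ≈⟨ ⊕-cong {M (reverse γ)} {M (reverse γ)} {ρ R} {φ R}
                                             (λ _ → ≈-refl) (≋.sym {φ R} {ρ R} φR≋ρR) ⟩
        M (reverse γ) ⊕ φ R       ∎)
        where
        open ≋-Reasoning
        γ  = toComposition w
        Mw = M γ
        R  = strictRefinements w
        split : L γ ≋ Mw ⊕ R
        split = L-toComposition-split w
        φR≋ρR : φ R ≋ ρ R
        φR≋ρR = φ≋ρ R (concat⁺ (All-map⁺ (universal strict-reverses (words n))))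
          where
          strict-reverses : ∀ v → All (Reverses ∘ proj₂)
                                      (if (w ⊑ v) ∧ not (does (w ≟ʷ v)) then M (toComposition v) else [])
          strict-reverses v with w ⊑ v in w⊑v | w ≟ʷ v
          ... | true  | no w≢v = IH v (⊏⇒falses-< w v w⊑v w≢v) ∷ []
          ... | true  | yes _  = []
          ... | false | _      = []

      reverses-toComposition : (w : Vec Bool n) → Reverses (toComposition w)
      reverses-toComposition w = reverses-below (suc (falses w)) w ≤-refl
        where
        reverses-below : ∀ k (u : Vec Bool n) → falses u < k → Reverses (toComposition u)
        reverses-below (suc k) u (s≤s u≤k) =
          reverses-step u (λ v v<u → reverses-below k v (≤-trans v<u u≤k))

      φ-K : ∀ a as → φ (K (suc a ∷ as)) ≋ ρ (K (suc a ∷ as))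
      φ-K a as = φ≋ρ (K α)
        (subst (All (Reverses ∘ proj₂)) (sym (concatMap-compositions N (kTerm α)))
               (concat⁺ (All-map⁺ (universal term-reverses (words N)))))
        where
        α = suc a ∷ as
        N = a + sum as
        term-reverses : ∀ v → All (Reverses ∘ proj₂) (kTerm α (toComposition v))
        term-reverses v with I α ⊆ᵇ I⁺ (toComposition v)
        ... | true  = reverses-toComposition v ∷ []
        ... | false = []

lemma5p6 : ∀ {c ℓ} (F : Field c ℓ) → let open QSymOver F in
    (φ : QSym → QSym) → IsLinear φ →
    (∀ (β : List ℕ) → IsComposition β → φ (L β) ≋ L (reverse β)) →
    ∀ (α : List ℕ) → IsPeak α → φ (K α) ≋ K (flat α)
lemma5p6 F φ linear hyp (suc a ∷ as) _ γ =
  Field.trans F (φ-K F φ linear hyp a as γ) (ρ-K F a as γ)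
lemma5p6 F φ linear hyp (zero ∷ _) (single ())
lemma5p6 F φ linear hyp (zero ∷ _) (cons () _)
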